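{- Let $G$ be a strongly connected directed co-graph with co-tree $T$, and let $\hat{w}$ be an inner node of $T$. Then no vertex $w \in V(G)\setminus V(G_{\hat{w}})$ resolves two vertices of $V(G_{\hat{w}})$ in $G$.
   Context: All graphs are finite and simple. For vertices $u,v$ of a directed graph $G$, $d_G(u,v)$ is the number of edges of a shortest directed path from $u$ to $v$ (undefined if no such path exists). $G$ is strongly connected if there is a directed path between every ordered pair of vertices. Two distinct vertices $u,v$ are resolved by a vertex $w$ in $G$ if $w=u$, or $w=v$, or there are paths from $w$ to $u$ and from $w$ to $v$ and $d_G(w,u)\neq d_G(w,v)$. Directed co-graphs and their co-trees are defined recursively: a single vertex $u$ is a directed co-graph whose co-tree is a single node $\hat u$ (the root, a leaf associated with $u$). If $G_1,G_2$ are directed co-graphs on disjoint vertex sets with co-trees $T_1,T_2$ rooted at $\hat l,\hat r$, then the disjoint union $G_1\cup G_2$ (edge set $E(G_1)\cup E(G_2)$), the join $G_1\times G_2$ (additionally all edges $(u,v),(v,u)$ with $u\in V(G_1),v\in V(G_2)$) and the directed join $G_1\gg G_2$ (additionally all edges $(u,v)$ with $u\in V(G_1), v\in V(G_2)$) are directed co-graphs; the co-tree is obtained from $T_1,T_2$ by adding a new root $\hat u$, labelled $\cup$, $\times$ or $\gg$ respectively, with left successor $\hat l$ and right successor $\hat r$. Non-leaf nodes are inner nodes. For a node $\hat w$ of $T$, $G_{\hat w}$ denotes the subgraph of $G$ induced by the vertices associated with the leaves of the subtree of $T$ rooted at $\hat w$. -}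

module Defs where

open import Data.Nat using (ℕ; zero; suc; _<_)
open import Data.Product using (Σ; ∃; _×_; _,_)
open import Data.Sum using (_⊎_)
open import Data.Empty using (⊥)
open import Data.Unit using (⊤)
open import Relation.Nullary using (¬_)
open import Relation.Binary.PropositionalEquality using (_≡_; _≢_)

data Op : Set where
  ∪op ×op ≫op : Op

data CoTree : Set where
  leaf : CoTree
  node : Op → CoTree → CoTree → CoTree

-- Leaves of a co-tree = vertices of the associated directed co-graph.
data Leaf : CoTree → Set where
  here  : Leaf leaf
  left  : ∀ {o l r} → Leaf l → Leaf (node o l r)
  right : ∀ {o l r} → Leaf r → Leaf (node o l r)

crossLR : Op → Set
crossLR ∪op = ⊥
crossLR ×op = ⊤
crossLR ≫op = ⊤

crossRL : Op → Set
crossRL ∪op = ⊥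
crossRL ×op = ⊤
crossRL ≫op = ⊥

Edge : (T : CoTree) → Leaf T → Leaf T → Set
Edge leaf here here = ⊥
Edge (node o l r) (left u)  (left v)  = Edge l u v
Edge (node o l r) (right u) (right v) = Edge r u v
Edge (node o l r) (left u)  (right v) = crossLR o
Edge (node o l r) (right u) (left v)  = crossRL o

data Walk (T : CoTree) : Leaf T → Leaf T → ℕ → Set where
  nil  : ∀ {u} → Walk T u u zero
  cons : ∀ {u v x k} → Edge T u v → Walk T v x k → Walk T u x (suc k)

-- d_G(u,v) = k : a directed walk of length k exists and none shorter
-- (shortest walk length = shortest path length).
Dist : (T : CoTree) → Leaf T → Leaf T → ℕ → Set
Dist T u v k = Walk T u v k × (∀ m → m < k → ¬ Walk T u v m)

StronglyConnected : CoTree → Set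
StronglyConnected T = ∀ (u v : Leaf T) → ∃ λ k → Walk T u v k

Resolves : (T : CoTree) → Leaf T → Leaf T → Leaf T → Set
Resolves T w u v =
  w ≡ u ⊎ w ≡ v ⊎
  (Σ ℕ λ k₁ → Σ ℕ λ k₂ → Dist T w u k₁ × Dist T w v k₂ × k₁ ≢ k₂)

-- Nodes of a co-tree, as positions from the root.
data Pos : CoTree → Set where
  root : ∀ {T} → Pos T
  goL  : ∀ {o l r} → Pos l → Pos (node o l r)
  goR  : ∀ {o l r} → Pos r → Pos (node o l r)

subtree : ∀ {T} → Pos T → CoTree
subtree {T} root = T
subtree (goL p) = subtree p
subtree (goR p) = subtree p

Inner : ∀ {T} → Pos T → Set
Inner p with subtree p
... | leaf = ⊥
... | node _ _ _ = ⊤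

-- u ∈ V(G_p): the leaf u lies in the subtree rooted at p.
data _under_ : ∀ {T} → Leaf T → Pos T → Set where
  atRoot : ∀ {T} {u : Leaf T} → u under root
  inL : ∀ {o l r} {u : Leaf l} {p : Pos l} → u under p → left {o} {l} {r} u under goL p
  inR : ∀ {o l r} {u : Leaf r} {p : Pos r} → u under p → right {o} {l} {r} u under goR p

module Submission where

-- The leaves below a co-tree node form a module of G: every vertex outside
-- sees all of them through the same kind of edge, fixed by the operation at
-- the node where the two branches split.  A walk from an outside vertex w
-- into the module can therefore be redirected, at its first entering edge,
-- to any other vertex of the module without becoming longer.  Hence w is at
-- the same distance from all vertices of the module and resolves none of
-- its pairs.

open import Defs
open import Data.Nat using (ℕ; suc; _≤_; z≤n; s≤s)
open import Data.Nat.Properties using (≤-antisym; ≤-trans; ≮⇒≥)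
open import Data.Product using (∃; _×_; _,_)
open import Data.Sum using (inj₁; inj₂)
open import Data.Empty using (⊥-elim)
open import Relation.Nullary using (¬_; Dec; yes; no)
open import Relation.Binary.PropositionalEquality using (_≢_; refl)

_under?_ : ∀ {T} (u : Leaf T) (p : Pos T) → Dec (u under p)
u under? root = yes atRoot
left u  under? goL p with u under? p
... | yes u∈p = yes (inL u∈p)
... | no  u∉p = no λ { (inL u∈p) → u∉p u∈p }
right u under? goL p = no λ ()
left u  under? goR p = no λ ()
right u under? goR p with u under? p
... | yes u∈p = yes (inR u∈p)
... | no  u∉p = no λ { (inR u∈p) → u∉p u∈p }

edge-into-module : ∀ {T} (p : Pos T) {x u v : Leaf T} →
  ¬ (x under p) → u under p → v under p → Edge T x u → Edge T x v
edge-into-module root x∉p _ _ _ = ⊥-elim (x∉p atRoot)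
edge-into-module (goL p) {left x}  x∉p (inL u∈p) (inL v∈p) e =
  edge-into-module p (λ x∈p → x∉p (inL x∈p)) u∈p v∈p e
edge-into-module (goL p) {right x} x∉p (inL u∈p) (inL v∈p) e = e
edge-into-module (goR p) {right x} x∉p (inR u∈p) (inR v∈p) e =
  edge-into-module p (λ x∈p → x∉p (inR x∈p)) u∈p v∈p e
edge-into-module (goR p) {left x}  x∉p (inR u∈p) (inR v∈p) e = e

walk-into-module : ∀ {T} (p : Pos T) {w u v : Leaf T} {k} →
  ¬ (w under p) → u under p → v under p →
  Walk T w u k → ∃ λ m → m ≤ k × Walk T w v m
walk-into-module p w∉p u∈p v∈p nil = ⊥-elim (w∉p u∈p)
walk-into-module p w∉p u∈p v∈p (cons {v = y} e walk) with y under? p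
... | yes y∈p = 1 , s≤s z≤n , cons (edge-into-module p w∉p y∈p v∈p e) nil
... | no  y∉p with walk-into-module p y∉p u∈p v∈p walk
...   | m , m≤k , walk′ = suc m , s≤s m≤k , cons e walk′

dist-≤-of-shortcut : ∀ {T} {w u v : Leaf T} {k₁ k₂} →
  (∀ {k} → Walk T w u k → ∃ λ m → m ≤ k × Walk T w v m) →
  Dist T w u k₁ → Dist T w v k₂ → k₂ ≤ k₁
dist-≤-of-shortcut shortcut (walkᵤ , _) (_ , shortest) with shortcut walkᵤ
... | m , m≤k₁ , walkᵥ = ≤-trans (≮⇒≥ λ m<k₂ → shortest m m<k₂ walkᵥ) m≤k₁

dist-into-module-≤ : ∀ {T} (p : Pos T) {w u v : Leaf T} {k₁ k₂} →
  ¬ (w under p) → u under p → v under p →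
  Dist T w u k₁ → Dist T w v k₂ → k₂ ≤ k₁
dist-into-module-≤ p w∉p u∈p v∈p =
  dist-≤-of-shortcut (walk-into-module p w∉p u∈p v∈p)

lemma1 : (T : CoTree) → StronglyConnected T →
    (p : Pos T) → Inner p →
    (w : Leaf T) → ¬ (w under p) →
    (u v : Leaf T) → u under p → v under p → u ≢ v →
    ¬ Resolves T w u v
lemma1 T _ p _ w w∉p u v u∈p v∈p _ (inj₁ refl) = w∉p u∈p
lemma1 T _ p _ w w∉p u v u∈p v∈p _ (inj₂ (inj₁ refl)) = w∉p v∈p
lemma1 T _ p _ w w∉p u v u∈p v∈p _ (inj₂ (inj₂ (k₁ , k₂ , distᵤ , distᵥ , k₁≢k₂))) =
  k₁≢k₂ (≤-antisym (dist-into-module-≤ p w∉p v∈p u∈p distᵥ distᵤ)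
                   (dist-into-module-≤ p w∉p u∈p v∈p distᵤ distᵥ))
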